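{- Let $S$ and $T$ be bitstrings that differ by defects. Then $w(S)$ and $w(T)$ also differ by defects, and the number of defects of $(w(S),w(T))$ equals the number of defects of $(S,T)$.
   Context: Two bitstrings are balanced if they have the same length and the same number of ones. $w$ is the map on bitstrings that simultaneously replaces each $0$ by $001$ and each $1$ by $01$. Characters are indexed from $1$, $S[i]$ denoting the $i$-th character. For balanced $S,T$ of length $L$, a defect is an index $1\le i\le L-1$ such that the length-$(i-1)$ prefixes of $S$ and $T$ are balanced, $S[i]\neq T[i]$, $S[i]\neq S[i+1]$, and $S[i+1]\neq T[i+1]$. $S$ and $T$ differ by defects if they are balanced and for every index $1\le i\le L$ with $S[i]\neq T[i]$ there is a defect at index $i-1$ or at index $i$. -}

module Defs where

open import Data.Bool using (Bool; true; false)
import Data.Bool as B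
open import Data.Nat using (ℕ; zero; suc; _+_; _∸_; _≤_; _≤?_)
import Data.Nat as N
open import Data.List using (List; []; _∷_; _++_; length; take; map; filter; upTo; concatMap)
open import Data.Product using (_×_; _,_)
open import Data.Sum using (_⊎_)
open import Relation.Nullary using (¬_; Dec)
open import Relation.Nullary.Decidable using (_×-dec_; ¬?)
open import Relation.Binary.PropositionalEquality using (_≡_; _≢_)

-- Bitstrings: lists of booleans, false = 0, true = 1.
Bitstring : Set
Bitstring = List Bool

ones : Bitstring → ℕ
ones []           = 0
ones (true  ∷ s)  = suc (ones s)
ones (false ∷ s)  = ones s

Balanced : Bitstring → Bitstring → Set
Balanced S T = (length S ≡ length T) × (ones S ≡ ones T)

balanced? : (S T : Bitstring) → Dec (Balanced S T)
balanced? S T = (length S N.≟ length T) ×-dec (ones S N.≟ ones T)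

wChar : Bool → Bitstring
wChar false = false ∷ false ∷ true ∷ []
wChar true  = false ∷ true ∷ []

w : Bitstring → Bitstring
w []      = []
w (b ∷ s) = wChar b ++ w s

-- 1-indexed character access: S ! i = S[i] for 1 ≤ i ≤ length S
-- (out-of-range indices return false, but are never used below
--  since all uses are guarded by explicit range conditions)
_!_ : Bitstring → ℕ → Bool
[]      ! _           = false
(b ∷ s) ! zero        = false
(b ∷ s) ! suc zero    = b
(b ∷ s) ! suc (suc i) = s ! suc i

Defect : Bitstring → Bitstring → ℕ → Set
Defect S T i =
  (1 ≤ i) × (i ≤ length S ∸ 1) ×
  Balanced (take (i ∸ 1) S) (take (i ∸ 1) T) ×
  (S ! i ≢ T ! i) × (S ! i ≢ S ! suc i) × (S ! suc i ≢ T ! suc i)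

defect? : (S T : Bitstring) (i : ℕ) → Dec (Defect S T i)
defect? S T i =
  (1 ≤? i) ×-dec (i ≤? length S ∸ 1) ×-dec
  balanced? (take (i ∸ 1) S) (take (i ∸ 1) T) ×-dec
  ¬? (S ! i B.≟ T ! i) ×-dec ¬? (S ! i B.≟ S ! suc i) ×-dec
  ¬? (S ! suc i B.≟ T ! suc i)

DifferByDefects : Bitstring → Bitstring → Set
DifferByDefects S T =
  Balanced S T ×
  (∀ i → 1 ≤ i → i ≤ length S → S ! i ≢ T ! i →
     Defect S T (i ∸ 1) ⊎ Defect S T i)

numDefects : Bitstring → Bitstring → ℕ
numDefects S T = length (filter (defect? S T) (map suc (upTo (length S ∸ 1))))

-- (S,T) differ by defects exactly when T arises from S by transposing k disjoint
-- adjacent pairs 01 ↔ 10, and then the defects are precisely the first positions of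
-- the transposed pairs, so there are k of them. The morphism w sends equal letters to
-- equal blocks and the pair 01 / 10 to 00101 / 01001, which again differ by a single
-- transposition of adjacent letters; so w(T) arises from w(S) by k transpositions too.
module Submission where

open import Defs
open import Data.Bool using (Bool; true; false)
import Data.Bool as B
open import Data.Empty using (⊥-elim)
open import Data.List using ([]; _∷_; _++_; length; filter; applyUpTo)
open import Data.List.Properties using (map-upTo; filter-accept; filter-reject)
open import Data.Nat using (ℕ; zero; suc; _∸_; _≤_; _<_; z≤n; s≤s; s≤s⁻¹)
open import Data.Nat.Properties using (suc-injective)
open import Data.Product using (_×_; _,_; ∃; proj₁; proj₂; map₂)
open import Data.Product.Function.NonDependent.Propositional using (_×-⇔_)
open import Data.Sum using (_⊎_; inj₁; inj₂)
import Data.Sum as Sum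
open import Function using (const; _∘_)
open import Function.Bundles using (_⇔_; mk⇔; Equivalence)
open import Function.Construct.Composition using (_⇔-∘_)
open import Function.Construct.Identity using (⇔-id)
open import Function.Construct.Symmetry using (⇔-sym)
open import Level using (0ℓ)
open import Relation.Binary.PropositionalEquality using (_≡_; _≢_; refl; sym; trans; cong; module ≡-Reasoning)
open import Relation.Nullary using (¬_; yes; no; contradiction)
open import Relation.Unary using (Pred; Decidable)

open Equivalence using (to; from)

module _ {A B : Set} {P : Pred A 0ℓ} {Q : Pred B 0ℓ} (P? : Decidable P) (Q? : Decidable Q) where

  length-filter-applyUpTo-cong : ∀ {f g} → (∀ i → P (f i) ⇔ Q (g i)) → ∀ n →
    length (filter P? (applyUpTo f n)) ≡ length (filter Q? (applyUpTo g n))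
  length-filter-applyUpTo-cong         P⇔Q zero = refl
  length-filter-applyUpTo-cong {f} {g} P⇔Q (suc n) with P? (f 0) | Q? (g 0)
  ... | yes _  | yes _  = cong suc (length-filter-applyUpTo-cong (P⇔Q ∘ suc) n)
  ... | no  _  | no  _  = length-filter-applyUpTo-cong (P⇔Q ∘ suc) n
  ... | yes p  | no ¬q = contradiction (to (P⇔Q 0) p) ¬q
  ... | no ¬p | yes q  = contradiction (from (P⇔Q 0) q) ¬p

map-from-suc : {P Q : ℕ → Set} → ¬ P 0 → (∀ {j} → P (suc j) → Q (suc j)) → ∀ j → P j → Q j
map-from-suc ¬P₀ f zero    p = ⊥-elim (¬P₀ p)
map-from-suc ¬P₀ f (suc j) p = f p

suc≤∸1⇔< : ∀ {m n} → suc m ≤ n ∸ 1 ⇔ suc m < n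
suc≤∸1⇔< {n = zero}  = mk⇔ (λ ()) (λ ())
suc≤∸1⇔< {n = suc n} = mk⇔ s≤s s≤s⁻¹

data Distinct : Bool → Bool → Set where
  0≠1 : Distinct false true
  1≠0 : Distinct true false

Distinct⇒≢ : ∀ {a b} → Distinct a b → a ≢ b
Distinct⇒≢ 0≠1 ()
Distinct⇒≢ 1≠0 ()

Distinct-sym : ∀ {a b} → Distinct a b → Distinct b a
Distinct-sym 0≠1 = 1≠0
Distinct-sym 1≠0 = 0≠1

data Transposed : Bitstring → Bitstring → ℕ → Set where
  []   : Transposed [] [] 0
  keep : ∀ c {S T k} → Transposed S T k → Transposed (c ∷ S) (c ∷ T) k
  swap : ∀ {a b S T k} → Distinct a b → Transposed S T k → Transposed (a ∷ b ∷ S) (b ∷ a ∷ T) (suc k)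

ones-keep : ∀ c {S T} → ones (c ∷ S) ≡ ones (c ∷ T) ⇔ ones S ≡ ones T
ones-keep false = ⇔-id _
ones-keep true  = mk⇔ suc-injective (cong suc)

ones-swap : ∀ a b S → ones (a ∷ b ∷ S) ≡ ones (b ∷ a ∷ S)
ones-swap false false S = refl
ones-swap false true  S = refl
ones-swap true  false S = refl
ones-swap true  true  S = refl

balanced-keep : ∀ c {S T} → Balanced (c ∷ S) (c ∷ T) ⇔ Balanced S T
balanced-keep c = mk⇔ suc-injective (cong suc) ×-⇔ ones-keep c

balanced-swap : ∀ a b {S T} → Balanced (a ∷ b ∷ S) (b ∷ a ∷ T) ⇔ Balanced S T
balanced-swap a b {T = T} =
  (balanced-keep b ⇔-∘ balanced-keep a) ⇔-∘
  mk⇔ (map₂ (λ e → trans e (ones-swap b a T))) (map₂ (λ e → trans e (ones-swap a b T)))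

no-defect-at-0 : ∀ {S T} → ¬ Defect S T 0
no-defect-at-0 (() , _)

keep-no-defect-at-1 : ∀ c {S T} → ¬ Defect (c ∷ S) (c ∷ T) 1
keep-no-defect-at-1 c (_ , _ , _ , c≢c , _) = c≢c refl

swap-defect-at-1 : ∀ {a b S T} → Distinct a b → Defect (a ∷ b ∷ S) (b ∷ a ∷ T) 1
swap-defect-at-1 d =
  s≤s z≤n , s≤s z≤n , (refl , refl) , Distinct⇒≢ d , Distinct⇒≢ d , Distinct⇒≢ (Distinct-sym d)

swap-no-defect-at-2 : ∀ {a b S T} → Distinct a b → ¬ Defect (a ∷ b ∷ S) (b ∷ a ∷ T) 2
swap-no-defect-at-2 0≠1 (_ , _ , (_ , ()) , _)
swap-no-defect-at-2 1≠0 (_ , _ , (_ , ()) , _)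

defect-keep : ∀ c {S T j} → Defect (c ∷ S) (c ∷ T) (suc (suc j)) ⇔ Defect S T (suc j)
defect-keep c =
  mk⇔ (const (s≤s z≤n)) (const (s≤s z≤n)) ×-⇔ ⇔-sym suc≤∸1⇔< ×-⇔ balanced-keep c ×-⇔
  ⇔-id _ ×-⇔ ⇔-id _ ×-⇔ ⇔-id _

defect-swap : ∀ a b {S T j} → Defect (a ∷ b ∷ S) (b ∷ a ∷ T) (suc (suc (suc j))) ⇔ Defect S T (suc j)
defect-swap a b =
  mk⇔ (const (s≤s z≤n)) (const (s≤s z≤n)) ×-⇔ ⇔-sym suc≤∸1⇔< ⇔-∘ mk⇔ s≤s⁻¹ s≤s ×-⇔
  balanced-swap a b ×-⇔ ⇔-id _ ×-⇔ ⇔-id _ ×-⇔ ⇔-id _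

DefectsCover : Bitstring → Bitstring → Set
DefectsCover S T = ∀ i → 1 ≤ i → i ≤ length S → S ! i ≢ T ! i → Defect S T (i ∸ 1) ⊎ Defect S T i

cover-keep : ∀ c {S T} → DefectsCover (c ∷ S) (c ∷ T) ⇔ DefectsCover S T
cover-keep c {S} {T} = mk⇔ down up
  where
  down : DefectsCover (c ∷ S) (c ∷ T) → DefectsCover S T
  down cover (suc j) _ j<∣S∣ S≢T =
    Sum.map (lower j) (lower (suc j)) (cover (suc (suc j)) (s≤s z≤n) (s≤s j<∣S∣) S≢T)
    where
    lower : ∀ j → Defect (c ∷ S) (c ∷ T) (suc j) → Defect S T j
    lower = map-from-suc (keep-no-defect-at-1 c {S} {T}) (to (defect-keep c))

  up : DefectsCover S T → DefectsCover (c ∷ S) (c ∷ T)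
  up cover (suc zero)    _ _         c≢c = contradiction refl c≢c
  up cover (suc (suc j)) _ (s≤s j<∣S∣) S≢T =
    Sum.map (raise j) (raise (suc j)) (cover (suc j) (s≤s z≤n) j<∣S∣ S≢T)
    where
    raise : ∀ j → Defect S T j → Defect (c ∷ S) (c ∷ T) (suc j)
    raise = map-from-suc (no-defect-at-0 {S} {T}) (from (defect-keep c))

cover-swap : ∀ {a b S T} → Distinct a b → DefectsCover (a ∷ b ∷ S) (b ∷ a ∷ T) ⇔ DefectsCover S T
cover-swap {a} {b} {S} {T} d = mk⇔ down up
  where
  down : DefectsCover (a ∷ b ∷ S) (b ∷ a ∷ T) → DefectsCover S T
  down cover (suc j) _ j<∣S∣ S≢T =
    Sum.map (lower j) (lower (suc j)) (cover (suc (suc (suc j))) (s≤s z≤n) (s≤s (s≤s j<∣S∣)) S≢T)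
    where
    lower : ∀ j → Defect (a ∷ b ∷ S) (b ∷ a ∷ T) (suc (suc j)) → Defect S T j
    lower = map-from-suc (swap-no-defect-at-2 {S = S} {T} d) (to (defect-swap a b))

  up : DefectsCover S T → DefectsCover (a ∷ b ∷ S) (b ∷ a ∷ T)
  up cover (suc zero)          _ _ _ = inj₂ (swap-defect-at-1 {S = S} {T} d)
  up cover (suc (suc zero))    _ _ _ = inj₁ (swap-defect-at-1 {S = S} {T} d)
  up cover (suc (suc (suc j))) _ (s≤s (s≤s j<∣S∣)) S≢T =
    Sum.map (raise j) (raise (suc j)) (cover (suc j) (s≤s z≤n) j<∣S∣ S≢T)
    where
    raise : ∀ j → Defect S T j → Defect (a ∷ b ∷ S) (b ∷ a ∷ T) (suc (suc j))
    raise = map-from-suc (no-defect-at-0 {S} {T}) (from (defect-swap a b))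

differ-keep : ∀ c {S T} → DifferByDefects (c ∷ S) (c ∷ T) ⇔ DifferByDefects S T
differ-keep c = balanced-keep c ×-⇔ cover-keep c

differ-swap : ∀ {a b S T} → Distinct a b → DifferByDefects (a ∷ b ∷ S) (b ∷ a ∷ T) ⇔ DifferByDefects S T
differ-swap {a} {b} d = balanced-swap a b ×-⇔ cover-swap d

Transposed⇒differ : ∀ {S T k} → Transposed S T k → DifferByDefects S T
Transposed⇒differ []         = (refl , refl) , λ { (suc _) _ () _ }
Transposed⇒differ (keep c τ) = from (differ-keep c) (Transposed⇒differ τ)
Transposed⇒differ (swap d τ) = from (differ-swap d) (Transposed⇒differ τ)

data LeadingSwap : Bitstring → Bitstring → Set where
  swap : ∀ {a b S T} → Distinct a b → LeadingSwap (a ∷ b ∷ S) (b ∷ a ∷ T)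

leadingSwap : ∀ {a b a′ b′ S T} → a ≢ b → a ≢ a′ → a′ ≢ b′ → LeadingSwap (a ∷ a′ ∷ S) (b ∷ b′ ∷ T)
leadingSwap {false} {true}  {true}  {false} _ _ _ = swap 0≠1
leadingSwap {true}  {false} {false} {true}  _ _ _ = swap 1≠0
leadingSwap {false} {false}                 a≢b _    _     = contradiction refl a≢b
leadingSwap {true}  {true}                  a≢b _    _     = contradiction refl a≢b
leadingSwap {false} {true}  {false}         _   a≢a′ _     = contradiction refl a≢a′
leadingSwap {true}  {false} {true}          _   a≢a′ _     = contradiction refl a≢a′
leadingSwap {false} {true}  {true}  {true}  _   _    a′≢b′ = contradiction refl a′≢b′
leadingSwap {true}  {false} {false} {false} _   _    a′≢b′ = contradiction refl a′≢b′

defect-at-1⇒LeadingSwap : ∀ {S T} → Balanced S T → Defect S T 1 → LeadingSwap S T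
defect-at-1⇒LeadingSwap {_ ∷ []}                  _        (_ , () , _)
defect-at-1⇒LeadingSwap {_ ∷ _ ∷ _} {[]}          (() , _) _
defect-at-1⇒LeadingSwap {_ ∷ _ ∷ _} {_ ∷ []}      (() , _) _
defect-at-1⇒LeadingSwap {_ ∷ _ ∷ _} {_ ∷ _ ∷ _}   _        (_ , _ , _ , a≢b , a≢a′ , a′≢b′) =
  leadingSwap a≢b a≢a′ a′≢b′

differ⇒Transposed : ∀ S T → DifferByDefects S T → ∃ (Transposed S T)
differ⇒Transposed []      []      _        = 0 , []
differ⇒Transposed []      (_ ∷ _) ((() , _) , _)
differ⇒Transposed (_ ∷ _) []      ((() , _) , _)
differ⇒Transposed (a ∷ S) (b ∷ T) δ with a B.≟ b
... | yes refl = map₂ (keep a) (differ⇒Transposed S T (to (differ-keep a) δ))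
... | no a≢b with proj₂ δ 1 (s≤s z≤n) (s≤s z≤n) a≢b
...   | inj₁ D = contradiction D (no-defect-at-0 {a ∷ S} {b ∷ T})
...   | inj₂ D with defect-at-1⇒LeadingSwap (proj₁ δ) D
differ⇒Transposed (a ∷ b ∷ S) (b ∷ a ∷ T) δ | no _ | inj₂ _ | swap d =
  let k , τ = differ⇒Transposed S T (to (differ-swap d) δ) in suc k , swap d τ

keep-++ : ∀ u {S T k} → Transposed S T k → Transposed (u ++ S) (u ++ T) k
keep-++ []      τ = τ
keep-++ (c ∷ u) τ = keep c (keep-++ u τ)

w-Transposed : ∀ {S T k} → Transposed S T k → Transposed (w S) (w T) k
w-Transposed []           = []
w-Transposed (keep c τ)   = keep-++ (wChar c) (w-Transposed τ)
w-Transposed (swap 0≠1 τ) = keep false (swap 0≠1 (keep false (keep true (w-Transposed τ))))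
w-Transposed (swap 1≠0 τ) = keep false (swap 1≠0 (keep false (keep true (w-Transposed τ))))

numDefects-applyUpTo : ∀ S T → numDefects S T ≡ length (filter (defect? S T) (applyUpTo suc (length S ∸ 1)))
numDefects-applyUpTo S T = cong (length ∘ filter (defect? S T)) (map-upTo suc (length S ∸ 1))

numDefects-keep : ∀ c S T → numDefects (c ∷ S) (c ∷ T) ≡ numDefects S T
numDefects-keep c []      T = refl
numDefects-keep c (x ∷ S) T = begin
  numDefects (c ∷ x ∷ S) (c ∷ T)
    ≡⟨ numDefects-applyUpTo (c ∷ x ∷ S) (c ∷ T) ⟩
  length (filter D? (1 ∷ applyUpTo (suc ∘ suc) (length S)))
    ≡⟨ cong length (filter-reject D? (keep-no-defect-at-1 c {x ∷ S} {T})) ⟩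
  length (filter D? (applyUpTo (suc ∘ suc) (length S)))
    ≡⟨ length-filter-applyUpTo-cong D? (defect? (x ∷ S) T) (λ _ → defect-keep c) (length S) ⟩
  length (filter (defect? (x ∷ S) T) (applyUpTo suc (length S)))
    ≡⟨ numDefects-applyUpTo (x ∷ S) T ⟨
  numDefects (x ∷ S) T ∎
  where
  open ≡-Reasoning
  D? : Decidable (Defect (c ∷ x ∷ S) (c ∷ T))
  D? = defect? (c ∷ x ∷ S) (c ∷ T)

numDefects-swap : ∀ {a b} → Distinct a b → ∀ S T → numDefects (a ∷ b ∷ S) (b ∷ a ∷ T) ≡ suc (numDefects S T)
numDefects-swap {a} {b} d [] T =
  cong length (filter-accept (defect? (a ∷ b ∷ []) (b ∷ a ∷ T)) (swap-defect-at-1 {S = []} {T} d))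
numDefects-swap {a} {b} d (x ∷ S) T = begin
  numDefects (a ∷ b ∷ x ∷ S) (b ∷ a ∷ T)
    ≡⟨ numDefects-applyUpTo (a ∷ b ∷ x ∷ S) (b ∷ a ∷ T) ⟩
  length (filter D? (1 ∷ 2 ∷ applyUpTo (suc ∘ suc ∘ suc) (length S)))
    ≡⟨ cong length (filter-accept D? (swap-defect-at-1 {S = x ∷ S} {T} d)) ⟩
  suc (length (filter D? (2 ∷ applyUpTo (suc ∘ suc ∘ suc) (length S))))
    ≡⟨ cong (suc ∘ length) (filter-reject D? (swap-no-defect-at-2 {S = x ∷ S} {T} d)) ⟩
  suc (length (filter D? (applyUpTo (suc ∘ suc ∘ suc) (length S))))
    ≡⟨ cong suc (length-filter-applyUpTo-cong D? (defect? (x ∷ S) T) (λ _ → defect-swap a b) (length S)) ⟩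
  suc (length (filter (defect? (x ∷ S) T) (applyUpTo suc (length S))))
    ≡⟨ cong suc (numDefects-applyUpTo (x ∷ S) T) ⟨
  suc (numDefects (x ∷ S) T) ∎
  where
  open ≡-Reasoning
  D? : Decidable (Defect (a ∷ b ∷ x ∷ S) (b ∷ a ∷ T))
  D? = defect? (a ∷ b ∷ x ∷ S) (b ∷ a ∷ T)

numDefects-Transposed : ∀ {S T k} → Transposed S T k → numDefects S T ≡ k
numDefects-Transposed []                     = refl
numDefects-Transposed (keep c {S} {T} τ)     = trans (numDefects-keep c S T) (numDefects-Transposed τ)
numDefects-Transposed (swap {S = S} {T} d τ) = trans (numDefects-swap d S T) (cong suc (numDefects-Transposed τ))

corollary2 : (S T : Bitstring) → DifferByDefects S T →
    DifferByDefects (w S) (w T) × (numDefects (w S) (w T) ≡ numDefects S T)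
corollary2 S T δ =
  let k , τ = differ⇒Transposed S T δ
  in Transposed⇒differ (w-Transposed τ) ,
     trans (numDefects-Transposed (w-Transposed τ)) (sym (numDefects-Transposed τ))
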